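{- Let $G$ and $H$ be graphs with $\mathrm{oh}(G)=s$ and $\mathrm{oh}(H)=t$. Then $\mathrm{oh}(G\square H)\geq \mathrm{oh}(K_s\square K_t)$.
   Context: All graphs are finite, simple and loopless. $\mathrm{oh}(G)$ (Odd Hadwiger number) is the largest integer $m$ for which there exist $m$ pairwise vertex-disjoint trees $Z_1,\dots,Z_m$ in $G$ and a 2-colouring $c$ of $V(Z_1)\cup\dots\cup V(Z_m)$ that is proper on each $Z_k$, such that for every $k\neq k'$ there is an edge $xy\in E(G)$ with $x\in V(Z_k)$, $y\in V(Z_{k'})$, $c(x)=c(y)$. The Cartesian product $G\square H$ has vertex set $V(G)\times V(H)$, with $(v_1,u_1)\sim(v_2,u_2)$ iff ($v_1=v_2$ and $u_1u_2\in E(H)$) or ($u_1=u_2$ and $v_1v_2\in E(G)$). -}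

module Defs where

open import Data.Nat using (ℕ; _*_; _≤_)
open import Data.Fin using (Fin; remQuot)
open import Data.Bool using (Bool)
open import Data.Product using (Σ; ∃; ∃-syntax; _×_; _,_; proj₁; proj₂)
open import Data.Sum using (_⊎_; inj₁; inj₂)
open import Data.List using (List; []; _∷_; [_])
open import Data.List.Membership.Propositional using (_∈_; _∉_)
open import Relation.Nullary using (¬_)
open import Relation.Binary.PropositionalEquality using (_≡_; _≢_; refl; sym)

record Graph : Set₁ where
  field
    size  : ℕ
    Adj   : Fin size → Fin size → Set
    adj-sym : ∀ {x y} → Adj x y → Adj y x
    irrefl : ∀ {x} → ¬ Adj x x
open Graph public

K : ℕ → Graph
K s = record
  { size = s
  ; Adj = λ i j → i ≢ j
  ; adj-sym = λ p q → p (sym q)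
  ; irrefl = λ p → p refl
  }

-- Cartesian product G □ H; vertex k of Fin (|G| * |H|) encodes the pair remQuot |H| k.
_□_ : Graph → Graph → Graph
G □ H = record
  { size = size G * size H
  ; Adj = PA
  ; adj-sym = psym
  ; irrefl = pirr
  }
  where
  P : Fin (size G * size H) → Fin (size G) × Fin (size H)
  P = remQuot (size H)
  PA : Fin (size G * size H) → Fin (size G * size H) → Set
  PA p q = (proj₁ (P p) ≡ proj₁ (P q) × Adj H (proj₂ (P p)) (proj₂ (P q)))
         ⊎ (proj₂ (P p) ≡ proj₂ (P q) × Adj G (proj₁ (P p)) (proj₁ (P q)))
  psym : ∀ {p q} → PA p q → PA q p
  psym (inj₁ (e , a)) = inj₁ (sym e , Graph.adj-sym H a)
  psym (inj₂ (e , a)) = inj₂ (sym e , Graph.adj-sym G a)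
  pirr : ∀ {p} → ¬ PA p p
  pirr (inj₁ (_ , a)) = Graph.irrefl H a
  pirr (inj₂ (_ , a)) = Graph.irrefl G a

-- IsTree G vs es : the subgraph of G with vertex list vs and edge list es is a tree.
-- Trees are generated from a single vertex by repeatedly attaching a new leaf.
data IsTree (G : Graph) : List (Fin (size G)) → List (Fin (size G) × Fin (size G)) → Set where
  single : ∀ v → IsTree G [ v ] []
  grow   : ∀ {vs es u w} → IsTree G vs es → u ∈ vs → w ∉ vs → Adj G u w →
           IsTree G (w ∷ vs) ((u , w) ∷ es)

-- An odd K_m model in G: m pairwise disjoint trees Z_k (vertex lists V k, edge lists E k),
-- and a 2-colouring c, proper on each tree, such that each pair of distinct trees is joined
-- by a monochromatic edge of G.
record OddModel (G : Graph) (m : ℕ) : Set where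
  field
    V       : Fin m → List (Fin (size G))
    E       : Fin m → List (Fin (size G) × Fin (size G))
    tree    : ∀ k → IsTree G (V k) (E k)
    disjoint : ∀ k k' → k ≢ k' → ∀ x → x ∈ V k → x ∉ V k'
    c       : Fin (size G) → Bool
    proper  : ∀ k x y → (x , y) ∈ E k → c x ≢ c y
    joined  : ∀ k k' → k ≢ k' →
              ∃[ x ] ∃[ y ] (x ∈ V k × y ∈ V k' × Adj G x y × c x ≡ c y)

IsOH : Graph → ℕ → Set
IsOH G s = OddModel G s × (∀ m → OddModel G m → m ≤ s)

-- Let (Zᴳᵢ, c_G), (Zᴴⱼ, c_H) and (T_k, c_K) be odd models of K_s in G, of K_t in H and of K_m in
-- K_s □ K_t. Blow every vertex (i, j) of K_s □ K_t up into the blob Zᴳᵢ × Zᴴⱼ of G □ H, coloured by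
-- c(g, h) = c_G(g) ⊕ c_H(h) ⊕ c_K(i, j). A blob is connected and properly coloured, because along
-- its edges exactly one of c_G, c_H changes. Adjacent vertices of K_s □ K_t agree in one coordinate,
-- and the monochromatic edge joining the branch sets of the other coordinate yields an edge between
-- the two blobs whose ends agree in c_G ⊕ c_H: it is monochromatic under c exactly when the edge of
-- K_s □ K_t is monochromatic under c_K. So replacing each vertex of T_k by its blob gives properly
-- coloured trees forming an odd K_m model in G □ H.
{-# OPTIONS --safe #-}
module Submission where

open import Defs
open import Data.Nat using (ℕ; _*_)
open import Data.Bool using (Bool; false; _xor_)
open import Data.Bool.Properties using (xor-∧-commutativeRing)
open import Algebra.Bundles using (CommutativeRing)
open import Algebra.Properties.Group (CommutativeRing.+-group xor-∧-commutativeRing)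
  using () renaming (∙-cancelˡ to xor-cancelˡ; ∙-cancelʳ to xor-cancelʳ)
open import Data.Fin using (Fin; combine; remQuot)
open import Data.Fin.Properties using (any?; remQuot-combine; combine-remQuot; combine-injective)
  renaming (_≟_ to _≟ᶠ_)
open import Data.Maybe using (Maybe; just; nothing)
open import Data.Product using (_×_; _,_; proj₁; proj₂; ∃-syntax; ∃₂; uncurry)
open import Data.Sum using (_⊎_; inj₁; inj₂; swap)
open import Data.List using (List; []; _∷_; [_])
open import Data.List.Membership.Propositional using (_∈_; _∉_; find; lose)
open import Data.List.Relation.Unary.All as All using (All; []; _∷_)
open import Data.List.Relation.Unary.Any using (Any; here; there; toSum; fromSum)
open import Data.List.Relation.Unary.Any.Properties using (singleton⁻)
open import Data.Empty using (⊥-elim)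
open import Function using (_∘_; _⇔_; mk⇔; Equivalence)
open import Level using (0ℓ)
open import Relation.Binary using (Rel; Symmetric)
open import Relation.Binary.PropositionalEquality
  using (_≡_; _≢_; refl; sym; trans; cong; cong₂; subst; subst₂; ≢-sym; module ≡-Reasoning)
open import Relation.Nullary using (¬_; yes; no)
open import Relation.Unary using (Pred; _≐_; _∪_; _⊥_)
open import Relation.Unary.Properties using (≐-refl; ≐-trans)
open import Relation.Unary.Algebra using (∪-cong)

module _ {A : Graph} where

  IsTree-nonempty : ∀ {vs es} → IsTree A vs es → ∃[ v ] v ∈ vs
  IsTree-nonempty (single v)             = v , here refl
  IsTree-nonempty (grow {w = w} _ _ _ _) = w , here refl

  IsTree-edge : ∀ {vs es a b} → IsTree A vs es → (a , b) ∈ es → a ∈ vs × b ∈ vs × Adj A a b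
  IsTree-edge (grow _ u∈ _ uw) (here refl) = there u∈ , here refl , uw
  IsTree-edge (grow T _ _ _)   (there e∈)  =
    let a∈ , b∈ , ab = IsTree-edge T e∈ in there a∈ , there b∈ , ab

module _ {G H : Graph} where

  □-adj : ∀ {g g′ h h′} → (g ≡ g′ × Adj H h h′) ⊎ (h ≡ h′ × Adj G g g′) →
          Adj (G □ H) (combine g h) (combine g′ h′)
  □-adj = subst₂ Adj× (sym (remQuot-combine _ _)) (sym (remQuot-combine _ _))
    where
    Adj× : Fin (size G) × Fin (size H) → Fin (size G) × Fin (size H) → Set
    Adj× (g , h) (g′ , h′) = (g ≡ g′ × Adj H h h′) ⊎ (h ≡ h′ × Adj G g g′)

  □-adjˡ : ∀ {g g′ h} → Adj G g g′ → Adj (G □ H) (combine g h) (combine g′ h)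
  □-adjˡ gg′ = □-adj (inj₂ (refl , gg′))

  □-adjʳ : ∀ {g : Fin (size G)} {h h′} → Adj H h h′ → Adj (G □ H) (combine g h) (combine g h′)
  □-adjʳ hh′ = □-adj (inj₁ (refl , hh′))

module Branches {G : Graph} {s : ℕ} (M : OddModel G s) where
  open OddModel M
  open import Data.List.Membership.DecPropositional (_≟ᶠ_ {n = size G}) using (_∈?_)

  branch-unique : ∀ {x i j} → x ∈ V i → x ∈ V j → i ≡ j
  branch-unique {x} {i} {j} x∈ᵢ x∈ⱼ with i ≟ᶠ j
  ... | yes i≡j = i≡j
  ... | no  i≢j = ⊥-elim (disjoint i j i≢j x x∈ᵢ x∈ⱼ)

  branch : Fin (size G) → Maybe (Fin s)
  branch x with any? (λ i → x ∈? V i)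
  ... | yes (i , _) = just i
  ... | no  _       = nothing

  branch-correct : ∀ {x i} → x ∈ V i → branch x ≡ just i
  branch-correct {x} {i} x∈ with any? (λ i → x ∈? V i)
  ... | yes (j , x∈ⱼ) = cong just (branch-unique x∈ⱼ x∈)
  ... | no  x∉        = ⊥-elim (x∉ (i , x∈))

module SpanningTrees (L : Graph) {R : Rel (Fin (size L)) 0ℓ} (R-sym : Symmetric R) where

  Vertex : Set
  Vertex = Fin (size L)

  record SpanningTree (Q : Pred Vertex 0ℓ) : Set where
    field
      vertices : List Vertex
      edges    : List (Vertex × Vertex)
      isTree   : IsTree L vertices edges
      R-edges  : All (uncurry R) edges
      spans    : (_∈ vertices) ≐ Q

  open SpanningTree public

  Linked : Pred Vertex 0ℓ → Pred Vertex 0ℓ → Set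
  Linked P Q = ∃₂ λ x y → P x × Q y × Adj L x y × R x y

  ⋃ᴸ : {I : Set} → (I → Pred Vertex 0ℓ) → List I → Pred Vertex 0ℓ
  ⋃ᴸ Q is z = Any (λ i → Q i z) is

  private variable
    P Q : Pred Vertex 0ℓ
    u w : Vertex
    ws : List Vertex
    fs : List (Vertex × Vertex)

  resp-≐ : P ≐ Q → SpanningTree P → SpanningTree Q
  resp-≐ P≐Q T = record
    { vertices = vertices T ; edges = edges T ; isTree = isTree T ; R-edges = R-edges T
    ; spans = ≐-trans (spans T) P≐Q }

  attach : SpanningTree Q → Q u → ¬ Q w → Adj L u w → R u w → SpanningTree ((_≡ w) ∪ Q)
  attach T Qu ¬Qw uw Ruw = record
    { vertices = _ ∷ vertices T
    ; edges    = _ ∷ edges T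
    ; isTree   = grow (isTree T) (proj₂ (spans T) Qu) (¬Qw ∘ proj₁ (spans T)) uw
    ; R-edges  = Ruw ∷ R-edges T
    ; spans    = ≐-trans (toSum , fromSum) (∪-cong ≐-refl (spans T))
    }

  -- Induction on the grafted tree: when the link ends at its newest leaf w, that leaf is first
  -- attached to T, so the rest of the grafted tree gets re-rooted at the neighbour of w.
  graft : SpanningTree Q → IsTree L ws fs → All (uncurry R) fs → Q ⊥ (_∈ ws) →
          Linked Q (_∈ ws) → SpanningTree (Q ∪ (_∈ ws))
  graft T (single v) _ Q⊥ (_ , _ , Qx , here refl , xv , Rxv) =
    resp-≐ ( (λ { (inj₁ refl) → inj₂ (here refl) ; (inj₂ q) → inj₁ q })
           , (λ { (inj₁ q) → inj₂ q ; (inj₂ (here refl)) → inj₁ refl }) )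
      (attach T Qx (λ Qv → Q⊥ (Qv , here refl)) xv Rxv)
  graft T (grow S u∈ w∉ uw) (Ruw ∷ R-fs) Q⊥ (_ , _ , Qx , here refl , xw , Rxw) =
    resp-≐ ( (λ { (inj₁ (inj₁ refl)) → inj₂ (here refl) ; (inj₁ (inj₂ q)) → inj₁ q
                ; (inj₂ z∈) → inj₂ (there z∈) })
           , (λ { (inj₁ q) → inj₁ (inj₂ q) ; (inj₂ (here refl)) → inj₁ (inj₁ refl)
                ; (inj₂ (there z∈)) → inj₂ z∈ }) )
      (graft (attach T Qx (λ Qw → Q⊥ (Qw , here refl)) xw Rxw) S R-fs
        (λ { (inj₁ refl , w∈) → w∉ w∈ ; (inj₂ q , z∈) → Q⊥ (q , there z∈) })
        (_ , _ , inj₁ refl , u∈ , adj-sym L uw , R-sym Ruw))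
  graft T (grow S u∈ w∉ uw) (Ruw ∷ R-fs) Q⊥ (x , y , Qx , there y∈ , xy , Rxy) =
    resp-≐ ( (λ { (inj₁ refl) → inj₂ (here refl) ; (inj₂ (inj₁ q)) → inj₁ q
                ; (inj₂ (inj₂ z∈)) → inj₂ (there z∈) })
           , (λ { (inj₁ q) → inj₂ (inj₁ q) ; (inj₂ (here refl)) → inj₁ refl
                ; (inj₂ (there z∈)) → inj₂ (inj₂ z∈) }) )
      (attach (graft T S R-fs (λ (q , z∈) → Q⊥ (q , there z∈)) (x , y , Qx , y∈ , xy , Rxy))
        (inj₂ u∈) (λ { (inj₁ Qw) → Q⊥ (Qw , here refl) ; (inj₂ w∈) → w∉ w∈ }) uw Ruw)

  join : SpanningTree P → SpanningTree Q → P ⊥ Q → Linked P Q → SpanningTree (P ∪ Q)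
  join T S P⊥Q (x , y , Px , Qy , xy , Rxy) =
    resp-≐ (∪-cong ≐-refl (spans S))
      (graft T (isTree S) (R-edges S) (λ (p , z∈) → P⊥Q (p , proj₁ (spans S) z∈))
        (x , y , Px , proj₂ (spans S) Qy , xy , Rxy))

  expand : {A : Graph} (Q : Fin (size A) → Pred Vertex 0ℓ) → ∀ {as es} → IsTree A as es →
           (∀ {a} → a ∈ as → SpanningTree (Q a)) →
           (∀ {a b z} → Q a z → Q b z → a ≡ b) →
           (∀ {a b} → (a , b) ∈ es → Linked (Q a) (Q b)) →
           SpanningTree (⋃ᴸ Q as)
  expand Q (single a) S Q-unique links = resp-≐ (here , singleton⁻) (S (here refl))
  expand Q (grow {vs = as} {w = w} T u∈ w∉ _) S Q-unique links =
    resp-≐ (fromSum ∘ swap , swap ∘ toSum)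
      (join (expand Q T (S ∘ there) Q-unique (links ∘ there)) (S (here refl)) disjoint linked)
    where
    disjoint : ⋃ᴸ Q as ⊥ Q w
    disjoint (Qas , Qw) = let a , a∈ , Qa = find Qas in w∉ (subst (_∈ as) (Q-unique Qa Qw) a∈)

    linked : Linked (⋃ᴸ Q as) (Q w)
    linked = let x , y , Qx , Qy , xy , Rxy = links (here refl) in x , y , lose u∈ Qx , Qy , xy , Rxy

module ProductModel (G H : Graph) {s t m : ℕ}
                    (MG : OddModel G s) (MH : OddModel H t) (MK : OddModel (K s □ K t) m) where
  module MG = OddModel MG
  module MH = OddModel MH
  module MK = OddModel MK
  open Branches using (branch; branch-unique; branch-correct)

  πG : Fin (s * t) → Fin s
  πG p = proj₁ (remQuot {s} t p)

  πH : Fin (s * t) → Fin t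
  πH p = proj₂ (remQuot {s} t p)

  π-injective : ∀ {p q} → πG p ≡ πG q → πH p ≡ πH q → p ≡ q
  π-injective {p} {q} πG≡ πH≡ = begin
    p                     ≡⟨ combine-remQuot {s} t p ⟨
    combine (πG p) (πH p) ≡⟨ cong₂ combine πG≡ πH≡ ⟩
    combine (πG q) (πH q) ≡⟨ combine-remQuot {s} t q ⟩
    q                     ∎
    where open ≡-Reasoning

  base : Fin (size G) → Fin (size H) → Bool
  base g h = MG.c g xor MH.c h

  -- The value on vertices outside every branch set is irrelevant.
  tag : Maybe (Fin s) → Maybe (Fin t) → Bool
  tag (just i) (just j) = MK.c (combine i j)
  tag _        _        = false

  colour : Fin (size G) × Fin (size H) → Bool
  colour (g , h) = base g h xor tag (branch MG g) (branch MH h)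

  c : Fin (size (G □ H)) → Bool
  c z = colour (remQuot {size G} (size H) z)

  c-combine : ∀ {p g h} → g ∈ MG.V (πG p) → h ∈ MH.V (πH p) →
              c (combine g h) ≡ base g h xor MK.c p
  c-combine {p} {g} {h} g∈ h∈ = begin
    c (combine g h)                              ≡⟨ cong colour (remQuot-combine g h) ⟩
    base g h xor tag (branch MG g) (branch MH h) ≡⟨ cong₂ (λ i j → base g h xor tag i j)
                                                      (branch-correct MG g∈) (branch-correct MH h∈) ⟩
    base g h xor MK.c (combine (πG p) (πH p))    ≡⟨ cong (λ q → base g h xor MK.c q)
                                                      (combine-remQuot {s} t p) ⟩
    base g h xor MK.c p                          ∎
    where open ≡-Reasoning

  c≡⇒base≡ : ∀ {p g g′ h h′} → g ∈ MG.V (πG p) → h ∈ MH.V (πH p) →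
             g′ ∈ MG.V (πG p) → h′ ∈ MH.V (πH p) →
             c (combine g h) ≡ c (combine g′ h′) → base g h ≡ base g′ h′
  c≡⇒base≡ {p} g∈ h∈ g′∈ h′∈ c≡ =
    xor-cancelʳ (MK.c p) _ _ (trans (sym (c-combine g∈ h∈)) (trans c≡ (c-combine g′∈ h′∈)))

  open SpanningTrees (G □ H) {R = λ x y → c x ≢ c y} ≢-sym

  Line : Fin (s * t) → Fin (size G) → Pred Vertex 0ℓ
  Line p g = ⋃ᴸ (λ h → (_≡ combine g h)) (MH.V (πH p))

  Blob : Fin (s * t) → Pred Vertex 0ℓ
  Blob p = ⋃ᴸ (Line p) (MG.V (πG p))

  point : ∀ v → SpanningTree (_≡ v)
  point v = record
    { vertices = [ v ] ; edges = [] ; isTree = single v ; R-edges = [] ; spans = singleton⁻ , here }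

  line : ∀ {p g} → g ∈ MG.V (πG p) → SpanningTree (Line p g)
  line {p} {g} g∈ =
    expand (λ h → (_≡ combine g h)) (MH.tree (πH p)) (λ _ → point _) point-unique linked
    where
    point-unique : ∀ {h h′ z} → z ≡ combine g h → z ≡ combine g h′ → h ≡ h′
    point-unique z≡gh z≡gh′ = proj₂ (combine-injective g _ g _ (trans (sym z≡gh) z≡gh′))

    linked : ∀ {h h′} → (h , h′) ∈ MH.E (πH p) → Linked (_≡ combine g h) (_≡ combine g h′)
    linked {h} {h′} e∈ =
      let h∈ , h′∈ , hh′ = IsTree-edge (MH.tree (πH p)) e∈
      in  _ , _ , refl , refl , □-adjʳ {G} {H} hh′
        , MH.proper (πH p) h h′ e∈ ∘ xor-cancelˡ (MG.c g) _ _ ∘ c≡⇒base≡ g∈ h∈ g∈ h′∈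

  blob : ∀ p → SpanningTree (Blob p)
  blob p = expand (Line p) (MG.tree (πG p)) line line-unique linked
    where
    line-unique : ∀ {g g′ z} → Line p g z → Line p g′ z → g ≡ g′
    line-unique z∈ z∈′ with find z∈ | find z∈′
    ... | h , _ , z≡gh | h′ , _ , z≡g′h′ =
      proj₁ (combine-injective _ h _ h′ (trans (sym z≡gh) z≡g′h′))

    h₀∈ : proj₁ (IsTree-nonempty (MH.tree (πH p))) ∈ MH.V (πH p)
    h₀∈ = proj₂ (IsTree-nonempty (MH.tree (πH p)))

    linked : ∀ {g g′} → (g , g′) ∈ MG.E (πG p) → Linked (Line p g) (Line p g′)
    linked {g} {g′} e∈ =
      let g∈ , g′∈ , gg′ = IsTree-edge (MG.tree (πG p)) e∈
      in  _ , _ , lose h₀∈ refl , lose h₀∈ refl , □-adjˡ {G} {H} gg′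
        , MG.proper (πG p) g g′ e∈ ∘ xor-cancelʳ _ _ _ ∘ c≡⇒base≡ g∈ h₀∈ g′∈ h₀∈

  blob-unique : ∀ {p q z} → Blob p z → Blob q z → p ≡ q
  blob-unique z∈p z∈q with find z∈p | find z∈q
  ... | g , g∈ , z∈ | g′ , g′∈ , z∈′ with find z∈ | find z∈′
  ... | h , h∈ , z≡gh | h′ , h′∈ , z≡g′h′
      with combine-injective g h g′ h′ (trans (sym z≡gh) z≡g′h′)
  ... | refl , refl = π-injective (branch-unique MG g∈ g′∈) (branch-unique MH h∈ h′∈)

  record Bridge (p q : Fin (s * t)) : Set where
    field
      x y         : Vertex
      x∈          : Blob p x
      y∈          : Blob q y
      adjacent    : Adj (G □ H) x y
      same-colour : c x ≡ c y ⇔ MK.c p ≡ MK.c q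

  bridge-between : ∀ {p q g h g′ h′} → g ∈ MG.V (πG p) → h ∈ MH.V (πH p) →
                   g′ ∈ MG.V (πG q) → h′ ∈ MH.V (πH q) →
                   Adj (G □ H) (combine g h) (combine g′ h′) → base g h ≡ base g′ h′ → Bridge p q
  bridge-between {p} {q} {g} {h} {g′} {h′} g∈ h∈ g′∈ h′∈ adj base≡ = record
    { x = combine g h ; y = combine g′ h′
    ; x∈ = lose g∈ (lose h∈ refl) ; y∈ = lose g′∈ (lose h′∈ refl)
    ; adjacent = adj
    ; same-colour = mk⇔
        (λ c≡ → xor-cancelˡ (base g′ h′) _ _ (trans (sym c-x) (trans c≡ c-y)))
        (λ cK≡ → trans c-x (trans (cong (base g′ h′ xor_) cK≡) (sym c-y)))
    }
    where
    c-x : c (combine g h) ≡ base g′ h′ xor MK.c p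
    c-x = trans (c-combine g∈ h∈) (cong (_xor MK.c p) base≡)

    c-y : c (combine g′ h′) ≡ base g′ h′ xor MK.c q
    c-y = c-combine g′∈ h′∈

  bridge : ∀ {p q} → Adj (K s □ K t) p q → Bridge p q
  bridge {p} {q} (inj₁ (πG≡ , πH≢)) =
    let h , h′ , h∈ , h′∈ , hh′ , cH≡ = MH.joined (πH p) (πH q) πH≢
        g , g∈ = IsTree-nonempty (MG.tree (πG p))
    in  bridge-between g∈ h∈ (subst (λ i → g ∈ MG.V i) πG≡ g∈) h′∈
          (□-adjʳ {G} {H} hh′) (cong (MG.c g xor_) cH≡)
  bridge {p} {q} (inj₂ (πH≡ , πG≢)) =
    let g , g′ , g∈ , g′∈ , gg′ , cG≡ = MG.joined (πG p) (πG q) πG≢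
        h , h∈ = IsTree-nonempty (MH.tree (πH p))
    in  bridge-between g∈ h∈ g′∈ (subst (λ j → h ∈ MH.V j) πH≡ h∈)
          (□-adjˡ {G} {H} gg′) (cong (_xor MH.c h) cG≡)

  branch-tree : ∀ k → SpanningTree (⋃ᴸ Blob (MK.V k))
  branch-tree k = expand Blob (MK.tree k) (λ _ → blob _) blob-unique linked
    where
    linked : ∀ {p q} → (p , q) ∈ MK.E k → Linked (Blob p) (Blob q)
    linked {p} {q} e∈ =
      let open Bridge (bridge (proj₂ (proj₂ (IsTree-edge (MK.tree k) e∈))))
      in  x , y , x∈ , y∈ , adjacent , MK.proper k p q e∈ ∘ Equivalence.to same-colour

  model : OddModel (G □ H) m
  model = record
    { V        = vertices ∘ branch-tree
    ; E        = edges ∘ branch-tree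
    ; tree     = isTree ∘ branch-tree
    ; disjoint = disjoint
    ; c        = c
    ; proper   = λ k _ _ → All.lookup (R-edges (branch-tree k))
    ; joined   = joined
    }
    where
    in-blob : ∀ {k z} → z ∈ vertices (branch-tree k) → ⋃ᴸ Blob (MK.V k) z
    in-blob {k} = proj₁ (spans (branch-tree k))

    from-blob : ∀ {k z} → ⋃ᴸ Blob (MK.V k) z → z ∈ vertices (branch-tree k)
    from-blob {k} = proj₂ (spans (branch-tree k))

    disjoint : ∀ k k′ → k ≢ k′ → ∀ z →
               z ∈ vertices (branch-tree k) → z ∉ vertices (branch-tree k′)
    disjoint k k′ k≢k′ z z∈ z∈′ with find (in-blob {k} z∈) | find (in-blob {k′} z∈′)
    ... | p , p∈ , z∈p | q , q∈ , z∈q =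
      MK.disjoint k k′ k≢k′ p p∈ (subst (_∈ MK.V k′) (blob-unique z∈q z∈p) q∈)

    joined : ∀ k k′ → k ≢ k′ → ∃[ x ] ∃[ y ]
             (x ∈ vertices (branch-tree k) × y ∈ vertices (branch-tree k′) × Adj (G □ H) x y × c x ≡ c y)
    joined k k′ k≢k′ =
      let p , q , p∈ , q∈ , pq , cK≡ = MK.joined k k′ k≢k′
          open Bridge (bridge pq)
      in  x , y , from-blob {k} (lose p∈ x∈) , from-blob {k′} (lose q∈ y∈)
        , adjacent , Equivalence.from same-colour cK≡

theorem7 : (G H : Graph) (s t : ℕ) → IsOH G s → IsOH H t →
           ∀ m → IsOH (K s □ K t) m → OddModel (G □ H) m
theorem7 G H s t (MG , _) (MH , _) m (MK , _) = ProductModel.model G H MG MH MK
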